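{- For $\ell\ge 3$ and $n\ge 0$ let $g_\ell(n)$ denote the number of independent sets (including the empty set) of the graph $G_\ell^n$, with $g_\ell(0)=1$. Then \[ \sum_{n\ge0} g_4(n)x^n=\frac{1+4x-x^2-2x^3}{1-3x-14x^2+15x^3+7x^4}, \] \[ \sum_{n\ge0} g_5(n)x^n=\frac{(1+x)(1+5x-8x^2)}{1-5x-30x^2+69x^3+31x^4-22x^5}, \] \[ \sum_{n\ge0} g_6(n)x^n=\frac{1+10x-12x^2-50x^3+10x^4+20x^5-12x^6}{1-8x-66x^2+280x^3+178x^4-532x^5-84x^6+108x^7}. \]
   Context: For integers $\ell\ge 3$ and $n\ge 1$, the graph $G_\ell^n$ is defined as follows. Start with $G_\ell^1=C_\ell$, the cycle on $\ell$ vertices. Given $G_\ell^{n-1}$, whose most recently added vertices form a cycle $C$ of length $\ell$ (for $n-1=1$, the original cycle), obtain $G_\ell^{n}$ by subdividing each edge of $C$ with a new vertex (corresponding to that edge, i.e. a vertex of the line graph $L(C)$) and then adding the edges of $L(C)$ among the new vertices (two new vertices are adjacent iff the corresponding edges of $C$ share an endpoint). Explicitly, $G_\ell^n$ has vertex set $\{(j,i): 1\le j\le n,\ i\in\mathbb{Z}/\ell\mathbb{Z}\}$, and its edges are: $(j,i)(j+1,i)$ and $(j,i+1)(j+1,i)$ for $1\le j\le n-1$ and $i\in\mathbb{Z}/\ell\mathbb{Z}$, together with $(n,i)(n,i+1)$ for $i\in\mathbb{Z}/\ell\mathbb{Z}$. $G_\ell^0$ is the empty graph, which has exactly one independent set.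 -}

module Defs where

open import Data.Bool using (Bool; true; false; _∧_; _∨_; not; if_then_else_)
open import Data.Nat using (ℕ; zero; suc; _∸_; NonZero; _≡ᵇ_)
open import Data.Nat.DivMod using (_mod_)
open import Data.Fin using (Fin; toℕ; _≟_)
open import Data.List using (List; []; _∷_; map; concatMap; allFin; filterᵇ; length; foldr; upTo)
open import Data.Vec using (Vec; lookup)
import Data.Vec as V
open import Data.Integer using (ℤ; +_; _*_; _+_; 0ℤ)
open import Data.Product using (_×_; _,_)
open import Relation.Nullary.Decidable using (⌊_⌋)
open import Relation.Binary.PropositionalEquality using (_≡_)

-- Vertices of G_ℓ^n: pairs (j , i), j : Fin n is the layer (0-indexed, so
-- layer j here is layer j+1 of the paper), i : Fin ℓ is the position in Z/ℓZ.
Vertex : ℕ → ℕ → Set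
Vertex n ℓ = Fin n × Fin ℓ

next : ∀ {ℓ} .{{_ : NonZero ℓ}} → Fin ℓ → Fin ℓ
next {ℓ} i = suc (toℕ i) mod ℓ

_≡Fᵇ_ : ∀ {k} → Fin k → Fin k → Bool
a ≡Fᵇ b = ⌊ a ≟ b ⌋

-- Directed edge list of the paper (0-indexed):
--   (j,i)(j+1,i) and (j,i+1)(j+1,i) for j+1 < n,
--   (n-1,i)(n-1,i+1) on the last layer.
edge : ∀ n ℓ .{{_ : NonZero ℓ}} → Vertex n ℓ → Vertex n ℓ → Bool
edge n ℓ (j , i) (j' , i') =
  ((toℕ j' ≡ᵇ suc (toℕ j)) ∧ ((i ≡Fᵇ i') ∨ (i ≡Fᵇ next i')))
  ∨ ((suc (toℕ j) ≡ᵇ n) ∧ (j ≡Fᵇ j') ∧ (i' ≡Fᵇ next i))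

adj : ∀ n ℓ .{{_ : NonZero ℓ}} → Vertex n ℓ → Vertex n ℓ → Bool
adj n ℓ u v = edge n ℓ u v ∨ edge n ℓ v u

allVertices : ∀ n ℓ → List (Vertex n ℓ)
allVertices n ℓ = concatMap (λ j → map (λ i → (j , i)) (allFin ℓ)) (allFin n)

Subset : ℕ → ℕ → Set
Subset n ℓ = Vertex n ℓ → Bool

allᵇ : ∀ {A : Set} → (A → Bool) → List A → Bool
allᵇ p = foldr (λ x b → p x ∧ b) true

independent : ∀ n ℓ .{{_ : NonZero ℓ}} → Subset n ℓ → Bool
independent n ℓ S =
  allᵇ (λ u → allᵇ (λ v → not (adj n ℓ u v ∧ S u ∧ S v)) (allVertices n ℓ)) (allVertices n ℓ)

allVecs : ∀ {A : Set} → List A → (k : ℕ) → List (Vec A k)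
allVecs xs zero = V.[] ∷ []
allVecs xs (suc k) = concatMap (λ x → map (x V.∷_) (allVecs xs k)) xs

allSubsets : ∀ n ℓ → List (Subset n ℓ)
allSubsets n ℓ =
  map (λ rows → λ { (j , i) → lookup (lookup rows j) i })
      (allVecs (allVecs (true ∷ false ∷ []) ℓ) n)

-- g_ℓ(n) = number of independent sets of G_ℓ^n (g_ℓ(0) = 1: the empty graph)
g : ∀ ℓ .{{_ : NonZero ℓ}} → ℕ → ℕ
g ℓ n = length (filterᵇ (independent n ℓ) (allSubsets n ℓ))

-- coefficients of a polynomial given as its list of coefficients [c₀, c₁, …]
coeff : List ℤ → ℕ → ℤ
coeff [] _ = 0ℤ
coeff (c ∷ cs) zero = c
coeff (c ∷ cs) (suc k) = coeff cs k

convCoeff : List ℤ → (ℕ → ℕ) → ℕ → ℤ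
convCoeff D f n = foldr _+_ 0ℤ (map (λ k → coeff D k * + f (n ∸ k)) (upTo (suc n)))

-- Σ_{n≥0} f(n) xⁿ = N(x) / D(x) as formal power series, where D(0) = 1
-- (D invertible), i.e. D(x) · Σ f(n) xⁿ = N(x) coefficientwise.
HasGF : (ℕ → ℕ) → List ℤ → List ℤ → Set
HasGF f N D = ∀ n → convCoeff D f n ≡ coeff N n

-- Cutting G_ℓ^n into its n layers, a vertex set is independent iff the row of each layer is
-- compatible with the next one and the last row is independent in the cycle C_ℓ. Hence
-- g_ℓ(k+1) is the sum of the entries of Mᵏv, where M is the 0/1 compatibility matrix on the 2^ℓ
-- rows and v the indicator of the rows independent in C_ℓ. If the vectors Mv, …, M^(d+1)v satisfy
-- the recurrence with characteristic polynomial D of degree d, multiplying by M propagates it to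
-- all later vectors, so D(x) · Σ g_ℓ(n)xⁿ is a polynomial, equal to N once its first d + 2
-- coefficients agree. Both conditions are finite computations, checked by evaluation.

module Submission where

open import Defs
open import Data.Integer using (+_; -_)
open import Data.List using (_∷_; [])
open import Data.Product using (_×_)

open import Data.Bool using (Bool; true; false; _∧_; _∨_; not; if_then_else_; T; T?)
open import Data.Bool.Properties using (∧-assoc; ∧-comm; ∧-zeroʳ; ∧-identityʳ; ∨-identityʳ; ∨-comm; if-float; T-∧)
open import Data.Fin using (Fin; zero; suc; toℕ)
import Data.Fin
open import Data.Integer using (ℤ; 0ℤ; _+_; _*_; _≟_)
open import Data.Integer.Properties using (pos-+; *-zeroʳ; *-distribˡ-+; +-commutativeSemigroup)
open import Algebra.Properties.CommutativeSemigroup +-commutativeSemigroup using (interchange)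
open import Data.List using (List; map; foldr; _++_; _∷ʳ_; allFin; concatMap; filterᵇ; length; upTo; applyDownFrom; zipWith)
open import Data.List.Properties
  using (map-cong; map-∘; map-++; ++-identityʳ; map-tabulate; length-++; filter-++; filter-none;
         map-applyUpTo; map-applyDownFrom; applyDownFrom-∷ʳ; length-applyDownFrom)
open import Data.List.Relation.Unary.All as All using (All; []; _∷_)
open import Data.List.Relation.Unary.All.Properties using (map⁻)
import Data.Nat as ℕ
open import Data.Nat using (ℕ; zero; suc; NonZero; _≡ᵇ_; _∸_; _≤_; _<_; _≤?_; s≤s)
open import Data.Nat.ListAction using (sum)
open import Data.Nat.Properties using (+-comm; +-suc; +-identityʳ; ≰⇒>; m≤n⇒∃[o]m+o≡n; m<1+n⇒m<n∨m≡n; ≤-trans; m≤m+n)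
open import Data.Product using (_,_; proj₁; proj₂)
open import Data.Sum using (inj₁; inj₂)
open import Data.Unit using (tt)
open import Data.Vec using (Vec; []; _∷_; lookup)
open import Function using (_∘_; flip; Equivalence)
open import Relation.Nullary using (yes; no)
open import Relation.Nullary.Decidable using (⌊_⌋; toWitness)
open import Relation.Binary.PropositionalEquality using (_≡_; refl; sym; trans; cong; cong₂; subst; module ≡-Reasoning)

pairwise : {X Y : Set} → (X → Y → Bool) → List X → List Y → Bool
pairwise Q xs ys = allᵇ (λ x → allᵇ (Q x) ys) xs

module _ {X : Set} where

  allᵇ-true : (xs : List X) → allᵇ (λ _ → true) xs ≡ true
  allᵇ-true []       = refl
  allᵇ-true (x ∷ xs) = allᵇ-true xs

  allᵇ-cong : {p q : X → Bool} → (∀ x → p x ≡ q x) → ∀ xs → allᵇ p xs ≡ allᵇ q xs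
  allᵇ-cong p≗q []       = refl
  allᵇ-cong p≗q (x ∷ xs) = cong₂ _∧_ (p≗q x) (allᵇ-cong p≗q xs)

  allᵇ-++ : (p : X → Bool) (xs xs' : List X) → allᵇ p (xs ++ xs') ≡ allᵇ p xs ∧ allᵇ p xs'
  allᵇ-++ p []       xs' = refl
  allᵇ-++ p (x ∷ xs) xs' = trans (cong (p x ∧_) (allᵇ-++ p xs xs')) (sym (∧-assoc (p x) _ _))

  allᵇ-∧ : (p q : X → Bool) (xs : List X) → allᵇ (λ x → p x ∧ q x) xs ≡ allᵇ p xs ∧ allᵇ q xs
  allᵇ-∧ p q []       = refl
  allᵇ-∧ p q (x ∷ xs) with p x | q x
  ... | false | _     = refl
  ... | true  | true  = allᵇ-∧ p q xs
  ... | true  | false = sym (∧-zeroʳ (allᵇ p xs))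

allᵇ-map : {X Y : Set} (p : Y → Bool) (f : X → Y) (xs : List X) → allᵇ p (map f xs) ≡ allᵇ (p ∘ f) xs
allᵇ-map p f []       = refl
allᵇ-map p f (x ∷ xs) = cong (p (f x) ∧_) (allᵇ-map p f xs)

module _ {X Y : Set} where

  pairwise-true : (xs : List X) (ys : List Y) → pairwise (λ _ _ → true) xs ys ≡ true
  pairwise-true xs ys = trans (allᵇ-cong (λ _ → allᵇ-true ys) xs) (allᵇ-true xs)

  pairwise-cong : {Q Q' : X → Y → Bool} → (∀ x y → Q x y ≡ Q' x y) → ∀ xs ys → pairwise Q xs ys ≡ pairwise Q' xs ys
  pairwise-cong Q≗Q' xs ys = allᵇ-cong (λ x → allᵇ-cong (Q≗Q' x) ys) xs

  pairwise-++ˡ : (Q : X → Y → Bool) (xs xs' : List X) (ys : List Y) →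
                 pairwise Q (xs ++ xs') ys ≡ pairwise Q xs ys ∧ pairwise Q xs' ys
  pairwise-++ˡ Q xs xs' ys = allᵇ-++ _ xs xs'

  pairwise-++ʳ : (Q : X → Y → Bool) (xs : List X) (ys ys' : List Y) →
                 pairwise Q xs (ys ++ ys') ≡ pairwise Q xs ys ∧ pairwise Q xs ys'
  pairwise-++ʳ Q xs ys ys' = trans (allᵇ-cong (λ x → allᵇ-++ (Q x) ys ys') xs) (allᵇ-∧ _ _ xs)

  pairwise-flip : (Q : X → Y → Bool) (xs : List X) (ys : List Y) → pairwise Q xs ys ≡ pairwise (flip Q) ys xs
  pairwise-flip Q []       ys = sym (allᵇ-true ys)
  pairwise-flip Q (x ∷ xs) ys =
    trans (cong (allᵇ (Q x) ys ∧_) (pairwise-flip Q xs ys)) (sym (allᵇ-∧ (Q x) _ ys))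

pairwise-mapʳ : {X Y Y' : Set} (Q : X → Y' → Bool) (h : Y → Y') (xs : List X) (ys : List Y) →
                pairwise Q xs (map h ys) ≡ pairwise (λ x y → Q x (h y)) xs ys
pairwise-mapʳ Q h xs ys = allᵇ-cong (λ x → allᵇ-map (Q x) h ys) xs

pairwise-map : {X X' Y Y' : Set} (Q : X' → Y' → Bool) (f : X → X') (h : Y → Y') (xs : List X) (ys : List Y) →
               pairwise Q (map f xs) (map h ys) ≡ pairwise (λ x y → Q (f x) (h y)) xs ys
pairwise-map Q f h xs ys = trans (allᵇ-map _ f xs) (pairwise-mapʳ (Q ∘ f) h xs ys)

∧-dup : ∀ a b c → (a ∧ b) ∧ (b ∧ c) ≡ a ∧ (b ∧ c)
∧-dup false b     c = refl
∧-dup true  false c = refl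
∧-dup true  true  c = refl

pairwise-sym-++ : {X : Set} (Q : X → X → Bool) → (∀ x y → Q x y ≡ Q y x) → (xs ys : List X) →
                  pairwise Q (xs ++ ys) (xs ++ ys) ≡ pairwise Q xs xs ∧ (pairwise Q xs ys ∧ pairwise Q ys ys)
pairwise-sym-++ Q Q-sym xs ys = begin
  pairwise Q (xs ++ ys) (xs ++ ys)
    ≡⟨ pairwise-++ˡ Q xs ys (xs ++ ys) ⟩
  pairwise Q xs (xs ++ ys) ∧ pairwise Q ys (xs ++ ys)
    ≡⟨ cong₂ _∧_ (pairwise-++ʳ Q xs xs ys) (pairwise-++ʳ Q ys xs ys) ⟩
  (pairwise Q xs xs ∧ pairwise Q xs ys) ∧ (pairwise Q ys xs ∧ pairwise Q ys ys)
    ≡⟨ cong (λ b → (pairwise Q xs xs ∧ pairwise Q xs ys) ∧ (b ∧ pairwise Q ys ys)) ys-xs ⟩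
  (pairwise Q xs xs ∧ pairwise Q xs ys) ∧ (pairwise Q xs ys ∧ pairwise Q ys ys)
    ≡⟨ ∧-dup (pairwise Q xs xs) (pairwise Q xs ys) (pairwise Q ys ys) ⟩
  pairwise Q xs xs ∧ (pairwise Q xs ys ∧ pairwise Q ys ys) ∎
  where
  open ≡-Reasoning
  ys-xs : pairwise Q ys xs ≡ pairwise Q xs ys
  ys-xs = trans (pairwise-flip Q ys xs) (pairwise-cong (λ x y → Q-sym y x) xs ys)

count : {A : Set} → (A → Bool) → List A → ℕ
count p xs = length (filterᵇ p xs)

module _ {A : Set} where

  count-∷ : (p : A → Bool) (x : A) (xs : List A) → count p (x ∷ xs) ≡ (if p x then suc (count p xs) else count p xs)
  count-∷ p x xs with p x
  ... | true  = refl
  ... | false = refl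

  count-cong : {p q : A → Bool} → (∀ x → p x ≡ q x) → ∀ xs → count p xs ≡ count q xs
  count-cong         p≗q []       = refl
  count-cong {p} {q} p≗q (x ∷ xs) = begin
    count p (x ∷ xs)                                    ≡⟨ count-∷ p x xs ⟩
    (if p x then suc (count p xs) else count p xs)      ≡⟨ cong₂ (λ b n → if b then suc n else n) (p≗q x) (count-cong p≗q xs) ⟩
    (if q x then suc (count q xs) else count q xs)      ≡⟨ count-∷ q x xs ⟨
    count q (x ∷ xs)                                    ∎
    where open ≡-Reasoning

  count-++ : (p : A → Bool) (xs ys : List A) → count p (xs ++ ys) ≡ count p xs ℕ.+ count p ys
  count-++ p xs ys = trans (cong length (filter-++ (T? ∘ p) xs ys)) (length-++ (filterᵇ p xs))

  count-∧ : (b : Bool) (q : A → Bool) (xs : List A) → count (λ x → b ∧ q x) xs ≡ (if b then count q xs else 0)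
  count-∧ true  q xs = refl
  count-∧ false q xs = cong length (filter-none (T? ∘ λ _ → false) (All.universal (λ _ ()) xs))

module _ {A B : Set} where

  count-map : (p : B → Bool) (f : A → B) (xs : List A) → count p (map f xs) ≡ count (p ∘ f) xs
  count-map p f []       = refl
  count-map p f (x ∷ xs) = begin
    count p (f x ∷ map f xs)                                          ≡⟨ count-∷ p (f x) (map f xs) ⟩
    (if p (f x) then suc (count p (map f xs)) else count p (map f xs)) ≡⟨ cong (λ n → if p (f x) then suc n else n) (count-map p f xs) ⟩
    (if p (f x) then suc (count (p ∘ f) xs) else count (p ∘ f) xs)     ≡⟨ count-∷ (p ∘ f) x xs ⟨
    count (p ∘ f) (x ∷ xs)                                            ∎
    where open ≡-Reasoning

  count-concatMap : (p : B → Bool) (f : A → List B) (xs : List A) → count p (concatMap f xs) ≡ sum (map (count p ∘ f) xs)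
  count-concatMap p f []       = refl
  count-concatMap p f (x ∷ xs) = trans (count-++ p (f x) (concatMap f xs)) (cong (count p (f x) ℕ.+_) (count-concatMap p f xs))

-- Coefficients of D(x) · Σ f(n)xⁿ

sumℤ : List ℤ → ℤ
sumℤ = foldr _+_ 0ℤ

module _ {A : Set} where

  sumℤ-zero : {f : A → ℤ} {xs : List A} → All (λ x → f x ≡ 0ℤ) xs → sumℤ (map f xs) ≡ 0ℤ
  sumℤ-zero []         = refl
  sumℤ-zero (fx≡0 ∷ p) = cong₂ _+_ fx≡0 (sumℤ-zero p)

  sumℤ-+ : (f h : A → ℤ) (xs : List A) → sumℤ (map f xs) + sumℤ (map h xs) ≡ sumℤ (map (λ x → f x + h x) xs)
  sumℤ-+ f h []       = refl
  sumℤ-+ f h (x ∷ xs) = trans (interchange (f x) _ (h x) _) (cong (_+_ (f x + h x)) (sumℤ-+ f h xs))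

  sumℤ-* : (c : ℤ) (f : A → ℤ) (xs : List A) → c * sumℤ (map f xs) ≡ sumℤ (map (λ x → c * f x) xs)
  sumℤ-* c f []       = *-zeroʳ c
  sumℤ-* c f (x ∷ xs) = trans (*-distribˡ-+ c (f x) _) (cong (_+_ (c * f x)) (sumℤ-* c f xs))

  pos-sum : (f : A → ℕ) (xs : List A) → + sum (map f xs) ≡ sumℤ (map (λ x → + f x) xs)
  pos-sum f []       = refl
  pos-sum f (x ∷ xs) = trans (pos-+ (f x) _) (cong (_+_ (+ f x)) (pos-sum f xs))

applyDownFrom-cong : {A : Set} {f h : ℕ → A} → (∀ i → f i ≡ h i) → ∀ k → applyDownFrom f k ≡ applyDownFrom h k
applyDownFrom-cong f≗h zero    = refl
applyDownFrom-cong f≗h (suc k) = cong₂ _∷_ (f≗h k) (applyDownFrom-cong f≗h k)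

dot : List ℤ → List ℤ → ℤ
dot (d ∷ ds) (x ∷ xs) = d * x + dot ds xs
dot _        _        = 0ℤ

convCoeff-∷ : ∀ d ds f n → convCoeff (d ∷ ds) f (suc n) ≡ d * + f (suc n) + convCoeff ds f n
convCoeff-∷ d ds f n = cong (_+_ (d * + f (suc n)))
  (trans (cong sumℤ (map-applyUpTo suc (λ k → coeff (d ∷ ds) k * + f (suc n ∸ k)) (suc n)))
         (sym (cong sumℤ (map-applyUpTo (λ k → k) (λ k → coeff ds k * + f (n ∸ k)) (suc n)))))

convCoeff-dot : ∀ D f n → convCoeff D f n ≡ dot D (applyDownFrom (λ k → + f k) (suc n))
convCoeff-dot []          f n       = sumℤ-zero {f = λ k → coeff [] k * + f (n ∸ k)} (All.universal (λ _ → refl) (upTo (suc n)))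
convCoeff-dot (d ∷ [])    f zero    = refl
convCoeff-dot (d ∷ _ ∷ _) f zero    = refl
convCoeff-dot (d ∷ ds)    f (suc n) = trans (convCoeff-∷ d ds f n) (cong (_+_ (d * + f (suc n))) (convCoeff-dot ds f n))

dot-applyDownFrom-+ : ∀ D (F : ℕ → ℤ) k →
                      dot D (applyDownFrom F (length D ℕ.+ k)) ≡ dot D (applyDownFrom (λ i → F (k ℕ.+ i)) (length D))
dot-applyDownFrom-+ []       F k = refl
dot-applyDownFrom-+ (d ∷ ds) F k =
  cong₂ (λ x y → d * x + y) (cong F (+-comm (length ds) k)) (dot-applyDownFrom-+ ds F k)

dot-sum : ∀ {A : Set} D (H : ℕ → A → ℤ) xs k →
          dot D (applyDownFrom (λ i → sumℤ (map (H i) xs)) k) ≡ sumℤ (map (λ x → dot D (applyDownFrom (λ i → H i x) k)) xs)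
dot-sum []       H xs k       = sym (sumℤ-zero (All.universal (λ _ → refl) xs))
dot-sum (d ∷ ds) H xs zero    = sym (sumℤ-zero (All.universal (λ _ → refl) xs))
dot-sum (d ∷ ds) H xs (suc k) =
  trans (cong₂ _+_ (sumℤ-* d (H k) xs) (dot-sum ds H xs k)) (sumℤ-+ (λ x → d * H k x) _ xs)

dot-zeros : ∀ D k → dot D (applyDownFrom (λ _ → 0ℤ) k) ≡ 0ℤ
dot-zeros []       _       = refl
dot-zeros (d ∷ ds) zero    = refl
dot-zeros (d ∷ ds) (suc k) = cong₂ _+_ (*-zeroʳ d) (dot-zeros ds k)

dot-if : ∀ b D (h : ℕ → ℤ) k →
         dot D (applyDownFrom (λ i → if b then h i else 0ℤ) k) ≡ (if b then dot D (applyDownFrom h k) else 0ℤ)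
dot-if true  D h k = refl
dot-if false D h k = dot-zeros D k

coeff-beyond : ∀ N {n} → length N ≤ n → coeff N n ≡ 0ℤ
coeff-beyond []       _        = refl
coeff-beyond (c ∷ cs) (s≤s cs≤n) = coeff-beyond cs cs≤n

-- On xs = [f(m−1), …, f(0)], checks the coefficients of xⁿ, n < m, of D(x) · Σ f(n)xⁿ against N.
prefixAgrees : List ℤ → List ℤ → List ℤ → Bool
prefixAgrees N D []       = true
prefixAgrees N D (x ∷ xs) = ⌊ dot D (x ∷ xs) ≟ coeff N (length xs) ⌋ ∧ prefixAgrees N D xs

prefixAgrees-sound : ∀ N D F m → T (prefixAgrees N D (applyDownFrom F m)) →
                     ∀ k → k < m → dot D (applyDownFrom F (suc k)) ≡ coeff N k
prefixAgrees-sound N D F (suc m) ok k k<1+m with Equivalence.to T-∧ ok | m<1+n⇒m<n∨m≡n k<1+m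
... | head , _    | inj₂ refl = trans (toWitness head) (cong (coeff N) (length-applyDownFrom F k))
... | _    , tail | inj₁ k<m  = prefixAgrees-sound N D F m tail k k<m

-- Transfer matrices

zipWith-map-diag : {A B C E : Set} (f : B → C → E) (g : A → B) (h : A → C) (xs : List A) →
                   zipWith f (map g xs) (map h xs) ≡ map (λ x → f (g x) (h x)) xs
zipWith-map-diag f g h []       = refl
zipWith-map-diag f g h (x ∷ xs) = cong (f (g x) (h x) ∷_) (zipWith-map-diag f g h xs)

mulᵇ : List (List Bool) → List ℕ → List ℕ
mulᵇ M v = map (λ row → sum (zipWith (λ b x → if b then x else 0) row v)) M

-- [Mᵏ⁻¹v, …, Mv, v] ++ acc. Accumulating keeps each Mⁱv a single shared term, so evaluating
-- this list performs only k multiplications by M.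
reversedOrbit : List (List Bool) → List ℕ → List (List ℕ) → ℕ → List (List ℕ)
reversedOrbit M v acc zero    = acc
reversedOrbit M v acc (suc k) = reversedOrbit M (mulᵇ M v) (v ∷ acc) k

module Transfer {A : Set} (states : List A) (R : A → A → Bool) where

  IsOrbit : (ℕ → A → ℕ) → Set
  IsOrbit c = ∀ k a → c (suc k) a ≡ sum (map (λ b → if R a b then c k b else 0) states)

  matrix : List (List Bool)
  matrix = map (λ a → map (R a) states) states

  combine : List ℤ → List (List ℕ) → List ℤ
  combine (d ∷ ds) (w ∷ ws) = zipWith (λ x y → d * + x + y) w (combine ds ws)
  combine _        _        = map (λ _ → 0ℤ) states

  -- Applied to ws = [Mᵏv, …, v] with k = length D. The recurrence is required of Mv, M²v, … only:
  -- the initial vector v itself need not satisfy it.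
  certifies : List ℤ → List ℤ → ℤ → List (List ℕ) → Bool
  certifies N D f₀ ws =
    ⌊ All.all? (_≟ 0ℤ) (combine D ws) ⌋ ∧ prefixAgrees N D (map (λ w → + sum w) ws ∷ʳ f₀) ∧ ⌊ length N ≤? length D ⌋

  certifies-sound : ∀ N D f₀ ws → T (certifies N D f₀ ws) →
                    All (_≡ 0ℤ) (combine D ws) × T (prefixAgrees N D (map (λ w → + sum w) ws ∷ʳ f₀)) × length N ≤ length D
  certifies-sound N D f₀ ws ok
    with recurrence , rest ← Equivalence.to (T-∧ {⌊ All.all? (_≟ 0ℤ) (combine D ws) ⌋}) ok
    with agree , degree ← Equivalence.to (T-∧ {prefixAgrees N D (map (λ w → + sum w) ws ∷ʳ f₀)}) rest =
    toWitness recurrence , agree , toWitness degree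

  -- Σᵢ Dᵢ c(m + deg D − i, a): the defect at time m and state a of the recurrence with
  -- characteristic polynomial D.
  residual : List ℤ → (ℕ → A → ℕ) → ℕ → A → ℤ
  residual D c m a = dot D (applyDownFrom (λ i → + c (m ℕ.+ i) a) (length D))

  module _ {c : ℕ → A → ℕ} (orbit : IsOrbit c) where

    vector : ℕ → List ℕ
    vector k = map (c k) states

    mulᵇ-vector : ∀ k → mulᵇ matrix (vector k) ≡ vector (suc k)
    mulᵇ-vector k = trans (sym (map-∘ states)) (map-cong (λ a →
      trans (cong sum (zipWith-map-diag (λ b x → if b then x else 0) (R a) (c k) states)) (sym (orbit k a))) states)

    reversedOrbit-vector : ∀ j k → reversedOrbit matrix (vector j) (applyDownFrom vector j) k ≡ applyDownFrom vector (k ℕ.+ j)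
    reversedOrbit-vector j zero    = refl
    reversedOrbit-vector j (suc k) = begin
      reversedOrbit matrix (mulᵇ matrix (vector j)) (applyDownFrom vector (suc j)) k
        ≡⟨ cong (λ v → reversedOrbit matrix v (applyDownFrom vector (suc j)) k) (mulᵇ-vector j) ⟩
      reversedOrbit matrix (vector (suc j)) (applyDownFrom vector (suc j)) k
        ≡⟨ reversedOrbit-vector (suc j) k ⟩
      applyDownFrom vector (k ℕ.+ suc j)
        ≡⟨ cong (applyDownFrom vector) (+-suc k j) ⟩
      applyDownFrom vector (suc k ℕ.+ j) ∎
      where open ≡-Reasoning

    combine-vector : ∀ D k → combine D (applyDownFrom vector (length D ℕ.+ k)) ≡ map (residual D c k) states
    combine-vector []       k = refl
    combine-vector (d ∷ ds) k = begin
      zipWith (λ x y → d * + x + y) (vector (length ds ℕ.+ k)) (combine ds (applyDownFrom vector (length ds ℕ.+ k)))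
        ≡⟨ cong (zipWith (λ x y → d * + x + y) (vector (length ds ℕ.+ k))) (combine-vector ds k) ⟩
      zipWith (λ x y → d * + x + y) (vector (length ds ℕ.+ k)) (map (residual ds c k) states)
        ≡⟨ zipWith-map-diag (λ x y → d * + x + y) (c (length ds ℕ.+ k)) (residual ds c k) states ⟩
      map (λ a → d * + c (length ds ℕ.+ k) a + residual ds c k a) states
        ≡⟨ map-cong (λ a → cong (λ j → d * + c j a + residual ds c k a) (+-comm (length ds) k)) states ⟩
      map (residual (d ∷ ds) c k) states ∎
      where open ≡-Reasoning

    residual-suc : ∀ D m a → residual D c (suc m) a ≡ sumℤ (map (λ b → if R a b then residual D c m b else 0ℤ) states)
    residual-suc D m a = begin
      dot D (applyDownFrom (λ i → + c (suc m ℕ.+ i) a) (length D))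
        ≡⟨ cong (dot D) (applyDownFrom-cong (λ i → trans (cong +_ (orbit (m ℕ.+ i) a)) (pos-sum _ states)) (length D)) ⟩
      dot D (applyDownFrom (λ i → sumℤ (map (λ b → + (if R a b then c (m ℕ.+ i) b else 0)) states)) (length D))
        ≡⟨ dot-sum D (λ i b → + (if R a b then c (m ℕ.+ i) b else 0)) states (length D) ⟩
      sumℤ (map (λ b → dot D (applyDownFrom (λ i → + (if R a b then c (m ℕ.+ i) b else 0)) (length D))) states)
        ≡⟨ cong sumℤ (map-cong (λ b → trans (cong (dot D) (applyDownFrom-cong (λ i → if-float +_ (R a b)) (length D)))
                                            (dot-if (R a b) D (λ i → + c (m ℕ.+ i) b) (length D))) states) ⟩
      sumℤ (map (λ b → if R a b then residual D c m b else 0ℤ) states) ∎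
      where open ≡-Reasoning

    residual-vanishes : ∀ D → All (λ a → residual D c 1 a ≡ 0ℤ) states → ∀ m → All (λ a → residual D c (suc m) a ≡ 0ℤ) states
    residual-vanishes D base zero    = base
    residual-vanishes D base (suc m) = All.universal (λ a → trans (residual-suc D (suc m) a)
      (sumℤ-zero (All.map (λ {b} e → if-zero (R a b) e) (residual-vanishes D base m)))) states
      where
      if-zero : ∀ b {x} → x ≡ 0ℤ → (if b then x else 0ℤ) ≡ 0ℤ
      if-zero true  x≡0 = x≡0
      if-zero false _   = refl

    reversedOrbit-applyDownFrom : ∀ k → reversedOrbit matrix (vector 0) [] k ≡ applyDownFrom vector k
    reversedOrbit-applyDownFrom k = trans (reversedOrbit-vector 0 k) (cong (applyDownFrom vector) (+-identityʳ k))

    module _ (f : ℕ → ℕ) (f-suc : ∀ k → f (suc k) ≡ sum (vector k)) where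

      convCoeff-residual : ∀ D k → convCoeff D f (length D ℕ.+ k) ≡ sumℤ (map (residual D c k) states)
      convCoeff-residual D k = begin
        convCoeff D f (length D ℕ.+ k)
          ≡⟨ convCoeff-dot D f (length D ℕ.+ k) ⟩
        dot D (applyDownFrom F (suc (length D ℕ.+ k)))
          ≡⟨ cong (λ n → dot D (applyDownFrom F n)) (sym (+-suc (length D) k)) ⟩
        dot D (applyDownFrom F (length D ℕ.+ suc k))
          ≡⟨ dot-applyDownFrom-+ D F (suc k) ⟩
        dot D (applyDownFrom (λ i → + f (suc (k ℕ.+ i))) (length D))
          ≡⟨ cong (dot D) (applyDownFrom-cong (λ i → trans (cong +_ (f-suc (k ℕ.+ i))) (pos-sum (c (k ℕ.+ i)) states)) (length D)) ⟩
        dot D (applyDownFrom (λ i → sumℤ (map (λ a → + c (k ℕ.+ i) a) states)) (length D))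
          ≡⟨ dot-sum D (λ i a → + c (k ℕ.+ i) a) states (length D) ⟩
        sumℤ (map (residual D c k) states) ∎
        where
        open ≡-Reasoning
        F : ℕ → ℤ
        F i = + f i

      values-vector : ∀ m → map (λ w → + sum w) (applyDownFrom vector m) ∷ʳ + f 0 ≡ applyDownFrom (λ i → + f i) (suc m)
      values-vector m = trans
        (cong (_∷ʳ + f 0) (trans (map-applyDownFrom vector (λ w → + sum w) m) (applyDownFrom-cong (λ i → cong +_ (sym (f-suc i))) m)))
        (applyDownFrom-∷ʳ (λ i → + f i) m)

      initial-terms : ∀ N D → T (prefixAgrees N D (map (λ w → + sum w) (applyDownFrom vector (length D ℕ.+ 1)) ∷ʳ + f 0)) →
                      ∀ n → n ≤ length D → convCoeff D f n ≡ coeff N n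
      initial-terms N D agree n n≤D = trans (convCoeff-dot D f n)
        (prefixAgrees-sound N D (λ i → + f i) _ (subst (T ∘ prefixAgrees N D) (values-vector (length D ℕ.+ 1)) agree) n
          (s≤s (≤-trans n≤D (m≤m+n (length D) 1))))

      later-terms : ∀ N D → All (_≡ 0ℤ) (combine D (applyDownFrom vector (length D ℕ.+ 1))) → length N ≤ length D →
                    ∀ k → convCoeff D f (length D ℕ.+ suc k) ≡ coeff N (length D ℕ.+ suc k)
      later-terms N D recurrence degree k = begin
        convCoeff D f (length D ℕ.+ suc k)       ≡⟨ convCoeff-residual D (suc k) ⟩
        sumℤ (map (residual D c (suc k)) states) ≡⟨ sumℤ-zero (residual-vanishes D initial k) ⟩
        0ℤ                                       ≡⟨ coeff-beyond N (≤-trans degree (m≤m+n (length D) (suc k))) ⟨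
        coeff N (length D ℕ.+ suc k)             ∎
        where
        open ≡-Reasoning
        initial : All (λ a → residual D c 1 a ≡ 0ℤ) states
        initial = map⁻ (subst (All (_≡ 0ℤ)) (combine-vector D 1) recurrence)

      hasGF-of-certificate : ∀ N D → T (certifies N D (+ f 0) (reversedOrbit matrix (vector 0) [] (length D ℕ.+ 1))) → HasGF f N D
      hasGF-of-certificate N D ok n
        with recurrence , agree , degree ←
               certifies-sound N D (+ f 0) _ (subst (T ∘ certifies N D (+ f 0)) (reversedOrbit-applyDownFrom (length D ℕ.+ 1)) ok)
        with n ≤? length D
      ... | yes n≤D = initial-terms N D agree n n≤D
      ... | no n≰D with k , refl ← m≤n⇒∃[o]m+o≡n (≰⇒> n≰D) =
        subst (λ n → convCoeff D f n ≡ coeff N n) (+-suc (length D) k) (later-terms N D recurrence degree k)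

-- The layers of G_ℓ^n

layer : ∀ {n} ℓ → Fin n → List (Vertex n ℓ)
layer ℓ j = map (j ,_) (allFin ℓ)

shift : ∀ {n ℓ} → Vertex n ℓ → Vertex (suc n) ℓ
shift (j , i) = (suc j , i)

concatMap-layer-suc : ∀ {n ℓ} (js : List (Fin n)) →
                      concatMap (layer ℓ) (map suc js) ≡ map shift (concatMap (layer ℓ) js)
concatMap-layer-suc         []       = refl
concatMap-layer-suc {ℓ = ℓ} (j ∷ js) =
  trans (cong₂ _++_ (map-∘ (allFin ℓ)) (concatMap-layer-suc js)) (sym (map-++ shift (layer ℓ j) _))

allVertices-suc : ∀ n ℓ → allVertices (suc n) ℓ ≡ layer ℓ zero ++ map shift (allVertices n ℓ)
allVertices-suc n ℓ =
  cong (layer ℓ zero ++_) (trans (cong (concatMap (layer ℓ)) (sym (map-tabulate (λ j → j) suc))) (concatMap-layer-suc (allFin n)))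

≡Fᵇ-suc : ∀ {k} (a b : Fin k) → (suc a ≡Fᵇ suc b) ≡ (a ≡Fᵇ b)
≡Fᵇ-suc a b with a Data.Fin.≟ b
... | yes _ = refl
... | no  _ = refl

module Layers (ℓ : ℕ) .{{_ : NonZero ℓ}} where

  Row : Set
  Row = Vec Bool ℓ

  cycleAdjacent layerAdjacent : Fin ℓ → Fin ℓ → Bool
  cycleAdjacent i i' = (i' ≡Fᵇ next i) ∨ (i ≡Fᵇ next i')
  layerAdjacent i i' = (i ≡Fᵇ i') ∨ (i ≡Fᵇ next i')

  rowIndependent : Row → Bool
  rowIndependent r = pairwise (λ i i' → not (cycleAdjacent i i' ∧ lookup r i ∧ lookup r i')) (allFin ℓ) (allFin ℓ)

  compatible : Row → Row → Bool
  compatible r r' = pairwise (λ i i' → not (layerAdjacent i i' ∧ lookup r i ∧ lookup r' i')) (allFin ℓ) (allFin ℓ)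

  layersIndependent : ∀ {n} → Vec Row n → Bool
  layersIndependent []           = true
  layersIndependent (r ∷ [])     = rowIndependent r
  layersIndependent (r ∷ r' ∷ R) = compatible r r' ∧ layersIndependent (r' ∷ R)

  toSubset : ∀ {n} → Vec Row n → Subset n ℓ
  toSubset R (j , i) = lookup (lookup R j) i

  conflictFree : ∀ n → Subset n ℓ → Vertex n ℓ → Vertex n ℓ → Bool
  conflictFree n S u v = not (adj n ℓ u v ∧ S u ∧ S v)

  conflictFree-sym : ∀ n S u v → conflictFree n S u v ≡ conflictFree n S v u
  conflictFree-sym n S u v = cong₂ (λ a b → not (a ∧ b)) (∨-comm (edge n ℓ u v) _) (∧-comm (S u) (S v))

  adj-shift : ∀ n (u v : Vertex n ℓ) → adj (suc n) ℓ (shift u) (shift v) ≡ adj n ℓ u v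
  adj-shift n (j , i) (j' , i') rewrite ≡Fᵇ-suc j j' | ≡Fᵇ-suc j' j = refl

  edge-upward : ∀ {n} (j : Fin n) i i' → edge (suc n) ℓ (suc j , i') (zero , i) ≡ false
  edge-upward j i i' = ∧-zeroʳ _

  adj-top : ∀ n (j : Fin (suc n)) i i' →
            adj (suc (suc n)) ℓ (zero , i) (suc j , i') ≡ (toℕ j ≡ᵇ 0) ∧ layerAdjacent i i'
  adj-top n j i i' = trans (cong₂ _∨_ (∨-identityʳ _) (edge-upward j i i')) (∨-identityʳ _)

  module _ {n} (r r' : Row) (R : Vec Row n) where

    private
      S : Subset (suc (suc n)) ℓ
      S = toSubset (r ∷ r' ∷ R)
      S' : Subset (suc n) ℓ
      S' = toSubset (r' ∷ R)
      Q : Vertex (suc (suc n)) ℓ → Vertex (suc (suc n)) ℓ → Bool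
      Q = conflictFree (suc (suc n)) S

    conflictFree-top-top : pairwise Q (layer ℓ zero) (layer ℓ zero) ≡ true
    conflictFree-top-top = trans (pairwise-map Q (zero ,_) (zero ,_) (allFin ℓ) (allFin ℓ)) (pairwise-true (allFin ℓ) (allFin ℓ))

    conflictFree-top-lower : pairwise Q (layer ℓ zero) (map shift (allVertices (suc n) ℓ)) ≡ compatible r r'
    conflictFree-top-lower = begin
      pairwise Q (layer ℓ zero) (map shift (allVertices (suc n) ℓ))
        ≡⟨ pairwise-map Q (zero ,_) shift (allFin ℓ) (allVertices (suc n) ℓ) ⟩
      pairwise Q↓ (allFin ℓ) (allVertices (suc n) ℓ)
        ≡⟨ cong (pairwise Q↓ (allFin ℓ)) (allVertices-suc n ℓ) ⟩
      pairwise Q↓ (allFin ℓ) (layer ℓ zero ++ map shift (allVertices n ℓ))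
        ≡⟨ pairwise-++ʳ Q↓ (allFin ℓ) (layer ℓ zero) (map shift (allVertices n ℓ)) ⟩
      pairwise Q↓ (allFin ℓ) (layer ℓ zero) ∧ pairwise Q↓ (allFin ℓ) (map shift (allVertices n ℓ))
        ≡⟨ cong₂ _∧_ second-layer deeper-layers ⟩
      compatible r r' ∧ true
        ≡⟨ ∧-identityʳ (compatible r r') ⟩
      compatible r r' ∎
      where
      open ≡-Reasoning
      Q↓ : Fin ℓ → Vertex (suc n) ℓ → Bool
      Q↓ i w = Q (zero , i) (shift w)
      second-layer : pairwise Q↓ (allFin ℓ) (layer ℓ zero) ≡ compatible r r'
      second-layer = trans (pairwise-mapʳ Q↓ (zero ,_) (allFin ℓ) (allFin ℓ))
        (pairwise-cong (λ i i' → cong (λ b → not (b ∧ _)) (adj-top n zero i i')) (allFin ℓ) (allFin ℓ))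
      deeper-layers : pairwise Q↓ (allFin ℓ) (map shift (allVertices n ℓ)) ≡ true
      deeper-layers = begin
        pairwise Q↓ (allFin ℓ) (map shift (allVertices n ℓ))
          ≡⟨ pairwise-mapʳ Q↓ shift (allFin ℓ) (allVertices n ℓ) ⟩
        pairwise (λ i w → Q↓ i (shift w)) (allFin ℓ) (allVertices n ℓ)
          ≡⟨ pairwise-cong (λ i w → cong (λ b → not (b ∧ S (zero , i) ∧ S (shift (shift w))))
                                         (adj-top n (suc (proj₁ w)) i (proj₂ w)))
                           (allFin ℓ) (allVertices n ℓ) ⟩
        pairwise (λ _ _ → true) (allFin ℓ) (allVertices n ℓ)
          ≡⟨ pairwise-true (allFin ℓ) (allVertices n ℓ) ⟩
        true ∎

    conflictFree-lower-lower :
      pairwise Q (map shift (allVertices (suc n) ℓ)) (map shift (allVertices (suc n) ℓ)) ≡ independent (suc n) ℓ S'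
    conflictFree-lower-lower = trans (pairwise-map Q shift shift V V)
      (pairwise-cong (λ u v → cong (λ b → not (b ∧ S' u ∧ S' v)) (adj-shift (suc n) u v)) V V)
      where
      V : List (Vertex (suc n) ℓ)
      V = allVertices (suc n) ℓ

  independent-toSubset : ∀ n (R : Vec Row n) → independent n ℓ (toSubset R) ≡ layersIndependent R
  independent-toSubset zero [] = refl
  independent-toSubset (suc zero) (r ∷ []) =
    trans (cong (λ V → pairwise Q V V) (++-identityʳ (layer ℓ zero))) (pairwise-map Q (zero ,_) (zero ,_) (allFin ℓ) (allFin ℓ))
    where
    Q : Vertex 1 ℓ → Vertex 1 ℓ → Bool
    Q = conflictFree 1 (toSubset (r ∷ []))
  independent-toSubset (suc (suc n)) (r ∷ r' ∷ R) = begin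
    independent (suc (suc n)) ℓ S
      ≡⟨ cong (λ V → pairwise Q V V) (allVertices-suc (suc n) ℓ) ⟩
    pairwise Q (top ++ lower) (top ++ lower)
      ≡⟨ pairwise-sym-++ Q (conflictFree-sym (suc (suc n)) S) top lower ⟩
    pairwise Q top top ∧ (pairwise Q top lower ∧ pairwise Q lower lower)
      ≡⟨ cong₂ _∧_ (conflictFree-top-top r r' R) (cong₂ _∧_ (conflictFree-top-lower r r' R) (conflictFree-lower-lower r r' R)) ⟩
    compatible r r' ∧ independent (suc n) ℓ (toSubset (r' ∷ R))
      ≡⟨ cong (compatible r r' ∧_) (independent-toSubset (suc n) (r' ∷ R)) ⟩
    compatible r r' ∧ layersIndependent (r' ∷ R) ∎
    where
    open ≡-Reasoning
    S : Subset (suc (suc n)) ℓ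
    S = toSubset (r ∷ r' ∷ R)
    Q : Vertex (suc (suc n)) ℓ → Vertex (suc (suc n)) ℓ → Bool
    Q = conflictFree (suc (suc n)) S
    top lower : List (Vertex (suc (suc n)) ℓ)
    top = layer ℓ zero
    lower = map shift (allVertices (suc n) ℓ)

  rows : List Row
  rows = allVecs (true ∷ false ∷ []) ℓ

  extensions : ℕ → Row → ℕ
  extensions k r = count (λ R → layersIndependent (r ∷ R)) (allVecs rows k)

  g-suc : ∀ k → g ℓ (suc k) ≡ sum (map (extensions k) rows)
  g-suc k = begin
    g ℓ (suc k)
      ≡⟨ count-map (independent (suc k) ℓ) toSubset (allVecs rows (suc k)) ⟩
    count (λ R → independent (suc k) ℓ (toSubset R)) (allVecs rows (suc k))
      ≡⟨ count-cong (independent-toSubset (suc k)) (allVecs rows (suc k)) ⟩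
    count layersIndependent (allVecs rows (suc k))
      ≡⟨ count-concatMap layersIndependent (λ r → map (r ∷_) (allVecs rows k)) rows ⟩
    sum (map (λ r → count layersIndependent (map (r ∷_) (allVecs rows k))) rows)
      ≡⟨ cong sum (map-cong (λ r → count-map layersIndependent (r ∷_) (allVecs rows k)) rows) ⟩
    sum (map (extensions k) rows) ∎
    where open ≡-Reasoning

  extensions-orbit : Transfer.IsOrbit rows compatible extensions
  extensions-orbit k r = begin
    extensions (suc k) r
      ≡⟨ count-concatMap (λ R → layersIndependent (r ∷ R)) (λ r' → map (r' ∷_) (allVecs rows k)) rows ⟩
    sum (map (λ r' → count (λ R → layersIndependent (r ∷ R)) (map (r' ∷_) (allVecs rows k))) rows)
      ≡⟨ cong sum (map-cong (λ r' → trans (count-map (λ R → layersIndependent (r ∷ R)) (r' ∷_) (allVecs rows k))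
                                          (count-∧ (compatible r r') (λ R → layersIndependent (r' ∷ R)) (allVecs rows k))) rows) ⟩
    sum (map (λ r' → if compatible r r' then extensions k r' else 0) rows) ∎
    where open ≡-Reasoning

module _ (ℓ : ℕ) .{{_ : NonZero ℓ}} where

  open Layers ℓ
  open Transfer rows compatible

  certificate : List ℤ → List ℤ → Bool
  certificate N D = certifies N D (+ 1) (reversedOrbit matrix (map (extensions 0) rows) [] (length D ℕ.+ 1))

  g-hasGF : ∀ N D → T (certificate N D) → HasGF (g ℓ) N D
  g-hasGF = hasGF-of-certificate extensions-orbit (g ℓ) g-suc

theorem3p1 :
    HasGF (g 4) (+ 1 ∷ + 4 ∷ - + 1 ∷ - + 2 ∷ [])
                (+ 1 ∷ - + 3 ∷ - + 14 ∷ + 15 ∷ + 7 ∷ [])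
    × HasGF (g 5) (+ 1 ∷ + 6 ∷ - + 3 ∷ - + 8 ∷ [])
                  (+ 1 ∷ - + 5 ∷ - + 30 ∷ + 69 ∷ + 31 ∷ - + 22 ∷ [])
    × HasGF (g 6) (+ 1 ∷ + 10 ∷ - + 12 ∷ - + 50 ∷ + 10 ∷ + 20 ∷ - + 12 ∷ [])
                  (+ 1 ∷ - + 8 ∷ - + 66 ∷ + 280 ∷ + 178 ∷ - + 532 ∷ - + 84 ∷ + 108 ∷ [])
theorem3p1 = g-hasGF 4 N₄ D₄ tt , g-hasGF 5 N₅ D₅ tt , g-hasGF 6 N₆ D₆ tt
  where
  N₄ D₄ N₅ D₅ N₆ D₆ : List ℤ
  N₄ = + 1 ∷ + 4 ∷ - + 1 ∷ - + 2 ∷ []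
  D₄ = + 1 ∷ - + 3 ∷ - + 14 ∷ + 15 ∷ + 7 ∷ []
  N₅ = + 1 ∷ + 6 ∷ - + 3 ∷ - + 8 ∷ []
  D₅ = + 1 ∷ - + 5 ∷ - + 30 ∷ + 69 ∷ + 31 ∷ - + 22 ∷ []
  N₆ = + 1 ∷ + 10 ∷ - + 12 ∷ - + 50 ∷ + 10 ∷ + 20 ∷ - + 12 ∷ []
  D₆ = + 1 ∷ - + 8 ∷ - + 66 ∷ + 280 ∷ + 178 ∷ - + 532 ∷ - + 84 ∷ + 108 ∷ []
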